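{- For all $n\geq 0$, $D_n=s_n^{d_{n+1}}D_{n-k}$.
   Context: Fix $k\geq 2$, letters $a_1,\dots,a_k$ and positive integers $(d_i)_{i\geq1}$. Define $s_{1-k}=a_2,\dots,s_{ -1}=a_k,s_0=a_1$; $s_n=s_{n-1}^{d_n}\cdots s_0^{d_1}a_{n+1}$ for $1\leq n\leq k-1$; $s_n=s_{n-1}^{d_n}\cdots s_{n-k+1}^{d_{n-k+2}}s_{n-k}$ for $n\geq k$. Define $D_0=a_1^{d_1-1}$, $D_m=s_m^{d_{m+1}-1}s_{m-1}^{d_m}\cdots s_1^{d_2}s_0^{d_1}$ for $m\geq1$, and formally $D_{ -j}=a_{k+1-j}^{ -1}$ for $1\leq j\leq k$. Products involving inverse letters are computed in the free group on $\{a_1,\dots,a_k\}$. -}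

module Defs where

open import Data.Nat using (ℕ; zero; suc; _+_; _∸_; _≡ᵇ_; _<ᵇ_; _≤ᵇ_)
open import Data.Bool using (Bool; true; false; if_then_else_; _∧_; _xor_)
open import Data.Product using (_×_; _,_)
open import Data.List using (List; []; _∷_; _++_; concat; replicate; take; drop)
open import Data.Integer using (ℤ; +_; -[1+_])

-- Letters of the free group: a generator index i (the letter a_i) paired with a
-- sign (true = a_i, false = a_i⁻¹).  Only indices 1..k are ever used.
Letter : Set
Letter = ℕ × Bool

Word : Set
Word = List Letter

gen : ℕ → Word
gen i = (i , true) ∷ []

genInv : ℕ → Word
genInv i = (i , false) ∷ []

pow : Word → ℕ → Word
pow w e = concat (replicate e w)

push : Letter → Word → Word
push x [] = x ∷ []
push (i , b) ((j , c) ∷ r) =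
  if (i ≡ᵇ j) ∧ (b xor c) then r else (i , b) ∷ (j , c) ∷ r

-- Free-reduced normal form; two words are equal in the free group iff
-- their reduced forms are equal.
reduce : Word → Word
reduce [] = []
reduce (x ∷ w) = push x (reduce w)

-- element at position j (0-based) of a list of words, default []
at : List Word → ℕ → Word
at [] _ = []
at (w ∷ _) zero = w
at (_ ∷ ws) (suc j) = at ws j

-- prodExp m ws j = w_j^{d(m-j)} w_{j+1}^{d(m-j-1)} ... over the list ws
-- (first element gets exponent d m, the next d (m-1), ...).
prodExp : (ℕ → ℕ) → ℕ → List Word → Word
prodExp d m [] = []
prodExp d m (w ∷ ws) = pow w (d m) ++ prodExp d (m ∸ 1) ws

-- sList k d n = [ s_n , s_{n-1} , ... , s_0 ]
sList : ℕ → (ℕ → ℕ) → ℕ → List Word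
sList k d zero = gen 1 ∷ []
sList k d (suc n) = next ∷ prev
  where
    m = suc n
    prev = sList k d n
    next : Word
    next = if m <ᵇ k
           -- 1 ≤ m ≤ k-1 : s_m = s_{m-1}^{d_m} ⋯ s_0^{d_1} a_{m+1}
           then prodExp d m prev ++ gen (suc m)
           -- m ≥ k : s_m = s_{m-1}^{d_m} ⋯ s_{m-k+1}^{d_{m-k+2}} s_{m-k}
           else prodExp d m (take (k ∸ 1) prev) ++ at prev (k ∸ 1)

-- s_n for n ≥ 0  (the letters d i are d_i for i ≥ 1)
s : ℕ → (ℕ → ℕ) → ℕ → Word
s k d n = at (sList k d n) 0

tailProd : ℕ → (ℕ → ℕ) → ℕ → Word
tailProd k d zero = []
tailProd k d (suc i) = pow (s k d i) (d (suc i)) ++ tailProd k d i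

-- D_m = s_m^{d_{m+1}-1} s_{m-1}^{d_m} ⋯ s_0^{d_1} for m ≥ 0
-- (for m = 0 this is a_1^{d_1 - 1} = D_0).
D : ℕ → (ℕ → ℕ) → ℕ → Word
D k d m = pow (s k d m) (d (suc m) ∸ 1) ++ tailProd k d m

-- D indexed by integers: D_m for m ≥ 0, and D_{-j} = a_{k+1-j}⁻¹ for 1 ≤ j ≤ k
-- (-[1+ j'] is -(j'+1), so k+1-j = k - j'); out of range values are unused.
Dℤ : ℕ → (ℕ → ℕ) → ℤ → Word
Dℤ k d (+ m) = D k d m
Dℤ k d -[1+ j' ] = if suc j' ≤ᵇ k then genInv (k ∸ j') else []

module Submission where

-- Since D_n = s_n^{d_{n+1}-1} · T_n  with the tail product
-- T_n = s_{n-1}^{d_n} ⋯ s_0^{d_1}, and d_{n+1} ≥ 1, the proposition is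
-- equivalent to the factorisation  T_n = s_n · D_{n-k}  (lemma tail-factor).
-- This is shown by comparing n with k:
--   * n < k : by definition s_n = T_n · a_{n+1}, and D_{n-k} = a_{n+1}⁻¹, so
--     s_n · D_{n-k} freely reduces to T_n  (one cancellation a a⁻¹);
--   * n = k + m : s_n = W · s_m, where W = s_{n-1}^{d_n} ⋯ s_{m+1}^{d_{m+2}}
--     is the window of the last k-1 factors, and T_n = W · T_{m+1}
--     = W · s_m^{d_{m+1}} T_m = W · s_m · D_m = s_n · D_m, an identity of
--     words which holds even before free reduction.

open import Defs
open import Data.Nat using (ℕ; suc; _≤_)
open import Data.Integer using (+_; _-_)
open import Data.List using (_++_)
open import Relation.Binary.PropositionalEquality using (_≡_)

open import Data.Nat using (zero; _+_; _∸_; _<_; _≡ᵇ_; s≤s; z≤n)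
open import Data.Nat.Properties using (<⇒<ᵇ; <ᵇ⇒<; ≤⇒≤ᵇ; m≤m+n; m≤n+m; m+n∸n≡m; m+n≮m; <-≤-connex; m≤n⇒∃[o]m+o≡n)
open import Data.Integer using (-[1+_]; _⊖_)
open import Data.Integer.Properties using ([1+m]⊖[1+n]≡m⊖n; [+m]-[+n]≡m⊖n)
open import Data.Bool using (true; false; T; if_then_else_; _∧_)
open import Data.Unit using (tt)
open import Data.Empty using (⊥-elim)
open import Data.List using ([]; _∷_; take; foldr)
open import Data.List.Properties using (++-assoc; ++-identityʳ)
open import Data.Product using (_,_)
open import Data.Sum using (inj₁; inj₂)
open import Relation.Nullary using (¬_)
open import Relation.Binary.PropositionalEquality using (refl; sym; trans; cong; module ≡-Reasoning)
open ≡-Reasoning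

if-true : ∀ {A : Set} {b} {x y : A} → T b → (if b then x else y) ≡ x
if-true {b = true} _ = refl

if-false : ∀ {A : Set} {b} {x y : A} → ¬ T b → (if b then x else y) ≡ y
if-false {b = true}  ¬b = ⊥-elim (¬b tt)
if-false {b = false} _  = refl

reduce-++ : ∀ u v → reduce (u ++ v) ≡ foldr push (reduce v) u
reduce-++ []      v = refl
reduce-++ (x ∷ u) v = cong (push x) (reduce-++ u v)

reduce-congˡ : ∀ u {v v′} → reduce v ≡ reduce v′ → reduce (u ++ v) ≡ reduce (u ++ v′)
reduce-congˡ u {v} {v′} eq = begin
  reduce (u ++ v)              ≡⟨ reduce-++ u v ⟩
  foldr push (reduce v) u      ≡⟨ cong (λ r → foldr push r u) eq ⟩
  foldr push (reduce v′) u     ≡⟨ sym (reduce-++ u v′) ⟩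
  reduce (u ++ v′)             ∎

cancel-gen : ∀ u i → reduce (u ++ (gen i ++ genInv i)) ≡ reduce u
cancel-gen u i = begin
  reduce (u ++ (gen i ++ genInv i)) ≡⟨ reduce-congˡ u (if-true (i≡ᵇi i)) ⟩
  reduce (u ++ [])                  ≡⟨ cong reduce (++-identityʳ u) ⟩
  reduce u                          ∎
  where
  i≡ᵇi : ∀ i → T ((i ≡ᵇ i) ∧ true)
  i≡ᵇi zero    = tt
  i≡ᵇi (suc i) = i≡ᵇi i

pow-pred : ∀ w {e} → 1 ≤ e → pow w e ≡ w ++ pow w (e ∸ 1)
pow-pred w {suc e} _ = refl

pow-suc : ∀ w e → pow w (suc e) ≡ pow w e ++ w
pow-suc w zero    = ++-identityʳ w
pow-suc w (suc e) = trans (cong (w ++_) (pow-suc w e)) (sym (++-assoc w (pow w e) w))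

pow-absorb : ∀ w {e} v → 1 ≤ e → pow w (e ∸ 1) ++ (w ++ v) ≡ pow w e ++ v
pow-absorb w {suc e} v _ = begin
  pow w e ++ (w ++ v) ≡⟨ sym (++-assoc (pow w e) w v) ⟩
  (pow w e ++ w) ++ v ≡⟨ cong (_++ v) (sym (pow-suc w e)) ⟩
  pow w (suc e) ++ v  ∎

⊖-below : ∀ n t → n ⊖ (suc n + t) ≡ -[1+ t ]
⊖-below zero    t = refl
⊖-below (suc n) t = trans ([1+m]⊖[1+n]≡m⊖n n (suc n + t)) (⊖-below n t)

⊖-above : ∀ k m → (k + m) ⊖ k ≡ + m
⊖-above zero    m = refl
⊖-above (suc k) m = trans ([1+m]⊖[1+n]≡m⊖n (k + m) k) (⊖-above k m)

module Unfold (k : ℕ) (d : ℕ → ℕ) where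

  at-sList : ∀ j m → at (sList k d (j + m)) j ≡ s k d m
  at-sList zero    m = refl
  at-sList (suc j) m = at-sList j m

  prodExp-sList : ∀ i → prodExp d (suc i) (sList k d i) ≡ tailProd k d (suc i)
  prodExp-sList zero    = refl
  prodExp-sList (suc i) = cong (pow (s k d (suc i)) (d (suc (suc i))) ++_) (prodExp-sList i)

  tail-window : ∀ j m →
    prodExp d (suc (j + m)) (take j (sList k d (j + m))) ++ tailProd k d (suc m)
      ≡ tailProd k d (suc (j + m))
  tail-window zero    m = refl
  tail-window (suc j) m =
    trans (++-assoc (pow (s k d (suc (j + m))) (d (suc (suc (j + m))))) _ _)
          (cong (pow (s k d (suc (j + m))) (d (suc (suc (j + m)))) ++_) (tail-window j m))

  s-below : ∀ n → n < k → s k d n ≡ tailProd k d n ++ gen (suc n)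
  s-below zero    _   = refl
  s-below (suc i) i<k =
    trans (if-true (<⇒<ᵇ i<k)) (cong (_++ gen (suc (suc i))) (prodExp-sList i))

  tail-unfold : ∀ m → 1 ≤ d (suc m) → tailProd k d (suc m) ≡ s k d m ++ D k d m
  tail-unfold m 1≤d = begin
    pow (s k d m) (d (suc m)) ++ tailProd k d m
      ≡⟨ cong (_++ tailProd k d m) (pow-pred (s k d m) 1≤d) ⟩
    (s k d m ++ pow (s k d m) (d (suc m) ∸ 1)) ++ tailProd k d m
      ≡⟨ ++-assoc (s k d m) _ _ ⟩
    s k d m ++ D k d m ∎

open Unfold

s-above : ∀ k₁ d m →
  s (suc k₁) d (suc k₁ + m)
    ≡ prodExp d (suc (k₁ + m)) (take k₁ (sList (suc k₁) d (k₁ + m))) ++ s (suc k₁) d m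
s-above k₁ d m =
  trans (if-false (λ t → m+n≮m k₁ m (<ᵇ⇒< (k₁ + m) k₁ t)))
        (cong (prodExp d (suc (k₁ + m)) (take k₁ (sList (suc k₁) d (k₁ + m))) ++_)
              (at-sList (suc k₁) d k₁ m))

Dℤ-below : ∀ d n t → Dℤ (suc n + t) d (+ n - + (suc n + t)) ≡ genInv (suc n)
Dℤ-below d n t = begin
  Dℤ k d (n ⊖ k)  ≡⟨ cong (Dℤ k d) (⊖-below n t) ⟩
  Dℤ k d -[1+ t ] ≡⟨ if-true (≤⇒≤ᵇ (s≤s (m≤n+m t n))) ⟩
  genInv (k ∸ t)  ≡⟨ cong genInv (m+n∸n≡m (suc n) t) ⟩
  genInv (suc n)  ∎
  where k = suc n + t

Dℤ-above : ∀ k d m → Dℤ k d (+ (k + m) - + k) ≡ D k d m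
Dℤ-above k d m = cong (Dℤ k d) (trans ([+m]-[+n]≡m⊖n (k + m) k) (⊖-above k m))

tail-factor : ∀ k → 1 ≤ k → (d : ℕ → ℕ) → (∀ i → 1 ≤ i → 1 ≤ d i) → ∀ n →
  reduce (tailProd k d n) ≡ reduce (s k d n ++ Dℤ k d (+ n - + k))
tail-factor (suc k₁) _ d hd n with <-≤-connex n (suc k₁)
... | inj₁ n<k with m≤n⇒∃[o]m+o≡n n<k
...   | t , refl = begin
  reduce Tₙ                                      ≡⟨ sym (cancel-gen Tₙ (suc n)) ⟩
  reduce (Tₙ ++ (gen (suc n) ++ genInv (suc n))) ≡⟨ cong reduce (sym (++-assoc Tₙ _ _)) ⟩
  reduce ((Tₙ ++ gen (suc n)) ++ genInv (suc n)) ≡⟨ cong (λ w → reduce (w ++ genInv (suc n))) (sym (s-below k d n n<k)) ⟩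
  reduce (s k d n ++ genInv (suc n))            ≡⟨ cong (λ w → reduce (s k d n ++ w)) (sym (Dℤ-below d n t)) ⟩
  reduce (s k d n ++ Dℤ k d (+ n - + k))        ∎
  where
  k = suc n + t
  Tₙ = tailProd k d n
tail-factor (suc k₁) _ d hd n | inj₂ k≤n with m≤n⇒∃[o]m+o≡n k≤n
...   | m , refl = cong reduce (begin
  tailProd k d (k + m)          ≡⟨ sym (tail-window k d k₁ m) ⟩
  W ++ tailProd k d (suc m)     ≡⟨ cong (W ++_) (tail-unfold k d m (hd (suc m) (s≤s z≤n))) ⟩
  W ++ (s k d m ++ D k d m)     ≡⟨ sym (++-assoc W _ _) ⟩
  (W ++ s k d m) ++ D k d m     ≡⟨ cong (_++ D k d m) (sym (s-above k₁ d m)) ⟩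
  s k d (k + m) ++ D k d m      ≡⟨ cong (s k d (k + m) ++_) (sym (Dℤ-above k d m)) ⟩
  s k d (k + m) ++ Dℤ k d (+ (k + m) - + k) ∎)
  where
  k = suc k₁
  W = prodExp d (suc (k₁ + m)) (take k₁ (sList k d (k₁ + m)))

proposition4p4 : (k : ℕ) → 2 ≤ k → (d : ℕ → ℕ) → (∀ i → 1 ≤ i → 1 ≤ d i) →
    (n : ℕ) →
    reduce (D k d n) ≡ reduce (pow (s k d n) (d (suc n)) ++ Dℤ k d (+ n - + k))
proposition4p4 k (s≤s _) d hd n = begin
  reduce (pow S (d (suc n) ∸ 1) ++ tailProd k d n)
    ≡⟨ reduce-congˡ (pow S (d (suc n) ∸ 1)) (tail-factor k (s≤s z≤n) d hd n) ⟩
  reduce (pow S (d (suc n) ∸ 1) ++ (S ++ Dℤ k d (+ n - + k)))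
    ≡⟨ cong reduce (pow-absorb S (Dℤ k d (+ n - + k)) (hd (suc n) (s≤s z≤n))) ⟩
  reduce (pow S (d (suc n)) ++ Dℤ k d (+ n - + k)) ∎
  where S = s k d n
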